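{- The elements $\xi_{t_{\omega_1}},\dots,\xi_{t_{\omega_n}}$ are algebraically independent over $\mathbb Q$ in the homology algebra $\Lambda$.
   Context: Let $\Phi$ be a reduced irreducible finite crystallographic root system in an $n$-dimensional Euclidean space $V$, with simple roots $\alpha_i$, positive roots $\Phi^+$, highest root $\theta$, coroot lattice $Q^\vee$, fundamental weights $\omega_1,\dots,\omega_n$, weight lattice $P=\bigoplus\mathbb Z\omega_i$. $W_a=W\ltimes Q^\vee$ is the affine Weyl group (generated by $s_0=s_\theta t_{\theta^\vee},s_1,\dots,s_n$, acting on $V$ on the right, $t_\lambda$ translation by $\lambda$), and $w\in W_a$ is identified with the alcove $A_0w$, $A_0=\{x:0<(x,\alpha)<1\ \forall\alpha\in\Phi^+\}$. For $w\in W_a$ and $\lambda\in P$, $w\star t_\lambda$ is the unique element of $W_a$ with $A_0(w\star t_\lambda)=A_0w+\lambda$ as subsets of $V$. $W_a^{\Lambda_0}$ is the set of affine Grassmannian elements, i.e. those $w$ with $A_0w$ in the fundamental chamber $\{x:(x,\alpha)\ge0\ \forall\alpha\in\Phi^+\}$. $\Lambda$ is the rational homology ring of the affine Grassmannian associated with the untwisted affine type of $\Phi$: a commutative $\mathbb Q$-algebra with basis of affine Schubert classes $\{\xi_w:w\in W_a^{\Lambda_0}\}$, nonnegative integer structure constants, and the factorization property $\xi_{w\star t_{\omega_i}}=\xi_w\xi_{t_{\omega_i}}$ for $w\in W_a^{\Lambda_0}$, $1\le i\le n$, where $\xi_{t_{\omega_i}}:=\xi_{e\star t_{\omega_i}}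$.
   Formalization: The space V is ℚ^n with a rational-valued inner product instead of an n-dimensional Euclidean space, so alcoves, the fundamental chamber and their translates consist of rational points. -}

module Defs where

open import Level using (Level; suc; _⊔_)
open import Data.Nat as ℕ using (ℕ)
open import Data.Integer as ℤ using (ℤ)
open import Data.Rational as ℚ using (ℚ; 0ℚ; 1ℚ)
open import Data.Rational.Properties as ℚP using ()
open import Data.Fin using (Fin; _≟_)
open import Data.Bool using (Bool; true; false)
open import Data.Vec as Vec using (Vec; lookup; allFin; zipWith; replicate; foldr)
open import Data.List as List using (List; []; _∷_; map; filter; length; zip)
open import Data.List.Membership.Propositional using (_∈_)
open import Data.List.Relation.Unary.All as LAll using ()
open import Data.List.Relation.Unary.Unique.Propositional using (Unique)
open import Data.Vec.Relation.Unary.All as VAll using ()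
open import Data.Product using (Σ; ∃; _×_; _,_; proj₁; proj₂)
open import Data.Sum using (_⊎_)
open import Function.Bundles using (_⇔_)
open import Relation.Nullary using (¬_; yes; no)
open import Relation.Binary.PropositionalEquality using (_≡_; _≢_)
open import Algebra.Bundles using (CommutativeRing)
open import Algebra.Morphism.Structures using (IsRingHomomorphism)

-- Coordinates.  V = ℚ^n, written in the basis of simple roots
-- α_1,…,α_n (so α_i is the i-th standard basis vector).  The inner
-- product is given by the Gram matrix (α_i,α_j).

ℤ→ℚ : ℤ → ℚ
ℤ→ℚ z = z ℚ./ 1

V : ℕ → Set
V n = Vec ℚ n

Σ[_] : (n : ℕ) → (Fin n → ℚ) → ℚ
Σ[ n ] f = foldr _ ℚ._+_ 0ℚ (Vec.map f (allFin n))

_+ᵥ_ : ∀ {n} → V n → V n → V n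
_+ᵥ_ = zipWith ℚ._+_

toV : ∀ {n} → Vec ℤ n → V n
toV = Vec.map ℤ→ℚ

_·ᵢ_ : ∀ {n} → ℤ → Vec ℤ n → Vec ℤ n
k ·ᵢ v = Vec.map (k ℤ.*_) v

δ : ∀ {n} → Fin n → Fin n → ℚ
δ i j with i ≟ j
... | yes _ = 1ℚ
... | no _ = 0ℚ

simple : ∀ {n} → Fin n → Vec ℤ n
simple i = Vec.tabulate (kron i)
  where
  kron : ∀ {n} → Fin n → Fin n → ℤ
  kron i j with i ≟ j
  ... | yes _ = ℤ.+ 1
  ... | no _ = ℤ.+ 0

record RootSystem (n : ℕ) : Set where
  field
    gram     : Fin n → Fin n → ℚ
    roots    : List (Vec ℤ n)

  ip : V n → V n → ℚ
  ip x y = Σ[ n ] λ i → Σ[ n ] λ j → lookup x i ℚ.* (gram i j ℚ.* lookup y j)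

  ipℤ : Vec ℤ n → Vec ℤ n → ℚ
  ipℤ a b = ip (toV a) (toV b)

  field
    gram-sym    : ∀ i j → gram i j ≡ gram j i
    gram-posdef : ∀ (x : V n) → x ≢ replicate n 0ℚ → 0ℚ ℚ.< ip x x
    simple∈     : ∀ i → simple i ∈ roots
    zero∉       : ¬ (replicate n (ℤ.+ 0) ∈ roots)
    sign        : ∀ {α} → α ∈ roots →
                  VAll.All (ℤ._≥ ℤ.+ 0) α ⊎ VAll.All (ℤ._≤ ℤ.+ 0) α
    -- crystallographic and closed under reflections:
    -- ⟨β,α^∨⟩ = 2(β,α)/(α,α) is an integer m, and s_α β = β - m α ∈ Φ
    reflect     : ∀ {α β} → α ∈ roots → β ∈ roots →
                  Σ ℤ λ m → (ℤ→ℚ (ℤ.+ 2) ℚ.* ipℤ β α ≡ ℤ→ℚ m ℚ.* ipℤ α α)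
                          × (zipWith ℤ._-_ β (m ·ᵢ α) ∈ roots)
    reduced     : ∀ {α β} → α ∈ roots → β ∈ roots → (k m : ℤ) →
                  k ≢ ℤ.+ 0 → k ·ᵢ β ≡ m ·ᵢ α →
                  β ≡ α ⊎ β ≡ Vec.map ℤ.-_ α
    nonempty    : ∃ λ α → α ∈ roots
    irreducible : ∀ (S : Vec ℤ n → Bool) →
                  (∀ {α β} → α ∈ roots → β ∈ roots →
                     S α ≡ true → S β ≡ false → ipℤ α β ≡ 0ℚ) →
                  (∀ {α} → α ∈ roots → S α ≡ true) ⊎
                  (∀ {α} → α ∈ roots → S α ≡ false)

  posRoots : List (Vec ℤ n)
  posRoots = filter (λ α → VAll.all? (λ z → ℤ.+ 0 ℤ.≤? z) α) roots

  -- An element w ∈ W_a is identified with its alcove A_0 w.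
  -- An alcove is the set {x : k_α < (x,α) < k_α + 1 ∀ α ∈ Φ⁺}; we
  -- record it by its list of integers k_α (indexed along posRoots).

  InAlcove : List ℤ → V n → Set
  InAlcove ks x = LAll.All (λ p → ℤ→ℚ (proj₁ p) ℚ.< ip x (toV (proj₂ p))
                                × ip x (toV (proj₂ p)) ℚ.< ℤ→ℚ (proj₁ p) ℚ.+ 1ℚ)
                           (zip ks posRoots)

  IsAlcove : List ℤ → Set
  IsAlcove ks = length ks ≡ length posRoots × ∃ (InAlcove ks)

  A₀ : List ℤ
  A₀ = map (λ _ → ℤ.+ 0) posRoots

  IsGrassmannian : List ℤ → Set
  IsGrassmannian ks = IsAlcove ks ×
    (∀ x → InAlcove ks x → ∀ {α} → α ∈ posRoots → 0ℚ ℚ.≤ ip x (toV α))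

  -- w ⋆ t_λ = w′  :  A_0 w′ = A_0 w + λ as subsets of V
  Star : List ℤ → V n → List ℤ → Set
  Star w λ′ w′ = IsAlcove w′ ×
    (∀ x → InAlcove w′ x ⇔ (∃ λ y → InAlcove w y × x ≡ y +ᵥ λ′))

  AreFundamentalWeights : (Fin n → V n) → Set
  AreFundamentalWeights ω = ∀ i j → ip (ω i) (toV (simple j)) ≡ δ i j

-- Commutative ℚ-algebras: a commutative ring with a unital ring
-- homomorphism ι : ℚ → R (scalar multiplication c · x = ι c * x).

record QAlgebra (c ℓ : Level) : Set (suc (c ⊔ ℓ)) where
  field
    commRing : CommutativeRing c ℓ
  open CommutativeRing commRing public
  field
    ι       : ℚ → Carrier
    ι-isHom : IsRingHomomorphism ℚP.+-*-rawRing rawRing ι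

  lincomb : List (ℚ × Carrier) → Carrier
  lincomb = List.foldr (λ p acc → ι (proj₁ p) * proj₂ p + acc) 0#

  natcomb : List (ℕ × Carrier) → Carrier
  natcomb = List.foldr (λ p acc → ι (ℤ→ℚ (ℤ.+ proj₁ p)) * proj₂ p + acc) 0#

  _^_ : Carrier → ℕ → Carrier
  x ^ ℕ.zero = 1#
  x ^ ℕ.suc k = x * (x ^ k)

  monomial : ∀ {n} → (Fin n → Carrier) → Vec ℕ n → Carrier
  monomial x e = foldr _ _*_ 1# (zipWith (λ xi ei → xi ^ ei) (Vec.tabulate x) e)

  evalPoly : ∀ {n} → List (ℚ × Vec ℕ n) → (Fin n → Carrier) → Carrier
  evalPoly p x = lincomb (map (λ t → proj₁ t , monomial x (proj₂ t)) p)

  AlgebraicallyIndependent : ∀ {n} → (Fin n → Carrier) → Set ℓ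
  AlgebraicallyIndependent {n} x =
    ∀ (p : List (ℚ × Vec ℕ n)) → Unique (map proj₂ p) →
      evalPoly p x ≈ 0# → LAll.All (λ t → proj₁ t ≡ 0ℚ) p

-- Λ : a commutative ℚ-algebra with basis of Schubert classes
-- {ξ_w : w ∈ W_a^{Λ0}}, nonnegative integer structure constants and
-- the factorization ξ_{w ⋆ t_{ω_i}} = ξ_w ξ_{t_{ω_i}}.
-- ξ is given on label lists; only its values on W_a^{Λ0} matter.

record SchubertBasis {n : ℕ} (R : RootSystem n) (ω : Fin n → V n)
                     {c ℓ : Level} (Λ : QAlgebra c ℓ) : Set (c ⊔ ℓ) where
  open RootSystem R
  open QAlgebra Λ
  field
    ξ : List ℤ → Carrier
    independent : ∀ (ws : List (ℚ × List ℤ)) →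
                  LAll.All (λ t → IsGrassmannian (proj₂ t)) ws →
                  Unique (map proj₂ ws) →
                  lincomb (map (λ t → proj₁ t , ξ (proj₂ t)) ws) ≈ 0# →
                  LAll.All (λ t → proj₁ t ≡ 0ℚ) ws
    spanning    : ∀ (a : Carrier) → ∃ λ (ws : List (ℚ × List ℤ)) →
                  LAll.All (λ t → IsGrassmannian (proj₂ t)) ws ×
                  a ≈ lincomb (map (λ t → proj₁ t , ξ (proj₂ t)) ws)
    structure   : ∀ u v → IsGrassmannian u → IsGrassmannian v →
                  ∃ λ (ws : List (ℕ × List ℤ)) →
                  LAll.All (λ t → IsGrassmannian (proj₂ t)) ws ×
                  ξ u * ξ v ≈ natcomb (map (λ t → proj₁ t , ξ (proj₂ t)) ws)
    -- factorization ξ_{w⋆t_{ω_i}} = ξ_w ξ_{t_{ω_i}}, where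
    -- t_{ω_i} := e ⋆ t_{ω_i}
    factor      : ∀ w i w′ t → IsGrassmannian w →
                  Star w (ω i) w′ → Star A₀ (ω i) t →
                  ξ w′ ≈ ξ w * ξ t

-- Translating an alcove by a fundamental weight ω_i shifts the integer label of each
-- positive root α by the α_i-coordinate of α, so by the factorization property
-- ξ_{A₀} · ξ_{t_{ω_1}}^{e_1} ⋯ ξ_{t_{ω_n}}^{e_n} is the Schubert class of the
-- Grassmannian alcove A₀ + Σ e_i ω_i.  That alcove has label e_j at the simple root α_j,
-- so distinct exponent vectors give distinct Schubert classes.  Multiplying a vanishing
-- polynomial in the ξ_{t_{ω_i}} by ξ_{A₀} therefore yields a vanishing linear combination
-- of distinct Schubert classes, whose coefficients are zero by linear independence.
module Submission where

open import Defs
open import Level using (Level)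
open import Data.Nat using (ℕ)
open import Data.Fin using (Fin)
open import Data.Integer using (ℤ)
open import Data.List using (List)

open import Algebra.Bundles using (Semiring; CommutativeRing; CommutativeMonoid)
import Algebra.Properties.CommutativeSemigroup as CommutativeSemigroupProperties
import Algebra.Properties.Semiring.Sum as SemiringSum
import Data.Integer as ℤ
import Data.Integer.Properties as ℤP
import Data.Rational as ℚ
open import Data.Rational using (ℚ; 0ℚ; 1ℚ; mkℚ)
import Data.Rational.Properties as ℚP
open import Data.Nat using (z≤n)
open import Data.Nat.Divisibility using (∣1⇒≡1)
open import Data.Fin using (zero; suc; _≟_; punchIn)
open import Data.Fin.Properties using (punchInᵢ≢i)
import Data.Vec as Vec
open import Data.Vec using (Vec; []; _∷_; lookup; tabulate)
import Data.Vec.Properties as VP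
import Data.Vec.Relation.Unary.All as VAll
import Data.Vec.Relation.Unary.All.Properties as VAllP
open import Data.Vec.Functional using (Vector)
import Data.List as List
open import Data.List using ([]; _∷_)
import Data.List.Properties as LP
import Data.List.Relation.Unary.All as All
open import Data.List.Relation.Unary.All using ([]; _∷_)
import Data.List.Relation.Unary.All.Properties as AllP
open import Data.List.Membership.Propositional using (_∈_)
open import Data.List.Membership.Propositional.Properties using (∈-filter⁺; ∈-filter⁻)
open import Data.List.Relation.Unary.Unique.Propositional using (Unique)
import Data.List.Relation.Unary.Unique.Propositional.Properties as UniqueP
open import Data.Product using (∃; _×_; _,_; proj₁; proj₂; map₂)
open import Function using (_∘_; id; _∋_)
open import Function.Bundles using (_⇔_; mk⇔; Equivalence)
open import Function.Construct.Composition using (_⇔-∘_)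
open import Function.Construct.Symmetry using (⇔-sym)
open import Relation.Nullary using (Dec; yes; no; contradiction)
open import Relation.Binary.PropositionalEquality
  using (_≡_; _≢_; refl; sym; trans; cong; cong₂; subst; subst₂; module ≡-Reasoning)

-- simple i is tabulated by an unnameable where-bound function; binding the unfolded
-- equation first lets the later with-abstraction over i ≟ j reach inside it.
simple-diagonal : ∀ {n} (i : Fin n) → lookup (simple i) i ≡ ℤ.+ 1
simple-diagonal i with (lookup (simple i) i ≡ _) ∋ VP.lookup∘tabulate _ i
... | lookup≡kron with i ≟ i
...   | yes _   = lookup≡kron
...   | no i≢i  = contradiction refl i≢i

simple-off-diagonal : ∀ {n} {i j : Fin n} → i ≢ j → lookup (simple i) j ≡ ℤ.+ 0
simple-off-diagonal {i = i} {j} i≢j with (lookup (simple i) j ≡ _) ∋ VP.lookup∘tabulate _ j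
... | lookup≡kron with i ≟ j
...   | yes i≡j = contradiction i≡j i≢j
...   | no _    = lookup≡kron

δ-diagonal : ∀ {n} (i : Fin n) → δ i i ≡ 1ℚ
δ-diagonal i with i ≟ i
... | yes _  = refl
... | no i≢i = contradiction refl i≢i

δ-off-diagonal : ∀ {n} {i j : Fin n} → i ≢ j → δ i j ≡ 0ℚ
δ-off-diagonal {i = i} {j} i≢j with i ≟ j
... | yes i≡j = contradiction i≡j i≢j
... | no _    = refl

module _ {c ℓ} (S : Semiring c ℓ) where
  open Semiring S
    using (Carrier; _≈_; _+_; _*_; 0#; 1#; setoid; +-cong; *-congˡ; *-identityʳ; +-identityʳ; zeroʳ)
    renaming (trans to ≈-trans)
  open SemiringSum S using (sum-syntax; sum-remove; sum-cong-≋; sum-replicate-zero)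
  open import Relation.Binary.Reasoning.Setoid setoid

  sum-indicator : ∀ {n} (f w : Vector Carrier n) k → w k ≈ 1# →
                  (∀ {j} → k ≢ j → w j ≈ 0#) → ∑[ j < n ] (f j * w j) ≈ f k
  sum-indicator {ℕ.zero}  f w () _ _
  sum-indicator {ℕ.suc n} f w k wk≈1 w≈0 = begin
    ∑[ j < ℕ.suc n ] (f j * w j)                                ≈⟨ sum-remove {i = k} (λ j → f j * w j) ⟩
    f k * w k + ∑[ j < n ] (f (punchIn k j) * w (punchIn k j))  ≈⟨ +-cong fk rest≈0 ⟩
    f k + 0#                                                    ≈⟨ +-identityʳ (f k) ⟩
    f k                                                         ∎
    where
    fk : f k * w k ≈ f k
    fk = ≈-trans (*-congˡ wk≈1) (*-identityʳ (f k))
    rest≈0 : ∑[ j < n ] (f (punchIn k j) * w (punchIn k j)) ≈ 0#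
    rest≈0 = ≈-trans (sum-cong-≋ (λ j → ≈-trans (*-congˡ (w≈0 (punchInᵢ≢i k j ∘ sym))) (zeroʳ _)))
                   (sum-replicate-zero n)

ℚ-semiring : Semiring _ _
ℚ-semiring = CommutativeRing.semiring ℚP.+-*-commutativeRing

module ℚΣ = SemiringSum ℚ-semiring
module ℤΣ = SemiringSum ℤP.+-*-semiring
open ℚΣ using (sum-syntax)

foldr-map-tabulate : ∀ {m n} (f : Fin n → ℚ) (g : Fin m → Fin n) →
                     Vec.foldr _ ℚ._+_ 0ℚ (Vec.map f (tabulate g)) ≡ ℚΣ.sum (f ∘ g)
foldr-map-tabulate {ℕ.zero}  f g = refl
foldr-map-tabulate {ℕ.suc m} f g = cong (f (g zero) ℚ.+_) (foldr-map-tabulate f (g ∘ suc))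

Σ≡sum : ∀ n (f : Fin n → ℚ) → Σ[ n ] f ≡ ℚΣ.sum f
Σ≡sum n f = foldr-map-tabulate f id

-- On the literal record mkℚ z 0, ℚ's _+_ and _≤_ compute to ℤ arithmetic.
ℤ→ℚ≡mkℚ : ∀ z → ℤ→ℚ z ≡ mkℚ z 0 (λ {d} d∣ → ∣1⇒≡1 (proj₂ d∣))
ℤ→ℚ≡mkℚ z = ℚP.↥p/↧p≡p (mkℚ z 0 _)

ℤ→ℚ-+ : ∀ a b → ℤ→ℚ (a ℤ.+ b) ≡ ℤ→ℚ a ℚ.+ ℤ→ℚ b
ℤ→ℚ-+ a b =
  trans (cong₂ (λ x y → (x ℤ.+ y) ℚ./ 1) (sym (ℤP.*-identityʳ a)) (sym (ℤP.*-identityʳ b)))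
        (sym (cong₂ ℚ._+_ (ℤ→ℚ≡mkℚ a) (ℤ→ℚ≡mkℚ b)))

ℤ→ℚ-mono-≤ : ∀ {a b} → a ℤ.≤ b → ℤ→ℚ a ℚ.≤ ℤ→ℚ b
ℤ→ℚ-mono-≤ {a} {b} a≤b =
  subst₂ ℚ._≤_ (sym (ℤ→ℚ≡mkℚ a)) (sym (ℤ→ℚ≡mkℚ b))
    (ℚ.*≤* (subst₂ ℤ._≤_ (sym (ℤP.*-identityʳ a)) (sym (ℤP.*-identityʳ b)) a≤b))

+-cancelʳ-< : ∀ c {a b} → a ℚ.+ c ℚ.< b ℚ.+ c → a ℚ.< b
+-cancelʳ-< c {a} {b} a+c<b+c =
  subst₂ ℚ._<_ (cancel a) (cancel b) (ℚP.+-monoˡ-< (ℚ.- c) a+c<b+c)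
  where
  cancel : ∀ x → (x ℚ.+ c) ℚ.- c ≡ x
  cancel x = trans (ℚP.+-assoc x c (ℚ.- c)) (trans (cong (x ℚ.+_) (ℚP.+-inverseʳ c)) (ℚP.+-identityʳ x))

Between : ℤ → ℚ → Set
Between k q = ℤ→ℚ k ℚ.< q × q ℚ.< ℤ→ℚ k ℚ.+ 1ℚ

between-translate : ∀ k m q → Between k q ⇔ Between (k ℤ.+ m) (q ℚ.+ ℤ→ℚ m)
between-translate k m q = mk⇔ to from
  where
  open CommutativeSemigroupProperties
    (CommutativeMonoid.commutativeSemigroup ℚP.+-0-commutativeMonoid) using (xy∙z≈xz∙y)
  K M : ℚ
  K = ℤ→ℚ k
  M = ℤ→ℚ m
  K+M≡ : K ℚ.+ M ≡ ℤ→ℚ (k ℤ.+ m)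
  K+M≡ = sym (ℤ→ℚ-+ k m)
  to : Between k q → Between (k ℤ.+ m) (q ℚ.+ M)
  to (lower , upper) =
    subst (ℚ._< q ℚ.+ M) K+M≡ (ℚP.+-monoˡ-< M lower) ,
    subst (q ℚ.+ M ℚ.<_) (trans (xy∙z≈xz∙y K 1ℚ M) (cong (ℚ._+ 1ℚ) K+M≡)) (ℚP.+-monoˡ-< M upper)
  from : Between (k ℤ.+ m) (q ℚ.+ M) → Between k q
  from (lower , upper) =
    +-cancelʳ-< M (subst (ℚ._< q ℚ.+ M) (sym K+M≡) lower) ,
    +-cancelʳ-< M (subst (q ℚ.+ M ℚ.<_) (trans (cong (ℚ._+ 1ℚ) (sym K+M≡)) (xy∙z≈xz∙y K M 1ℚ)) upper)

zip-map-self : ∀ {A B : Set} (f : A → B) (xs : List A) →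
               List.zip (List.map f xs) xs ≡ List.map (λ x → f x , x) xs
zip-map-self f []       = refl
zip-map-self f (x ∷ xs) = cong ((f x , x) ∷_) (zip-map-self f xs)

map-cong-local⁻ : ∀ {A B : Set} {f g : A → B} {xs : List A} →
                  List.map f xs ≡ List.map g xs → All.All (λ x → f x ≡ g x) xs
map-cong-local⁻ {xs = []}     _    = []
map-cong-local⁻ {xs = x ∷ xs} f≡g = LP.∷-injectiveˡ f≡g ∷ map-cong-local⁻ (LP.∷-injectiveʳ f≡g)

_+ᶠ_ : ∀ {A : Set} → (A → ℤ) → (A → ℤ) → A → ℤ
(f +ᶠ g) a = f a ℤ.+ g a

positive-rank : ∀ {n} → RootSystem n → Fin n
positive-rank {ℕ.zero} R with RootSystem.nonempty R
... | [] , []∈roots = contradiction []∈roots (RootSystem.zero∉ R)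
positive-rank {ℕ.suc n} R = zero

module Alcoves {n : ℕ} (R : RootSystem n) where
  open RootSystem R
  open ℚΣ using (sum-cong-≗; ∑-distrib-+; ∑-comm; *-distribʳ-sum)
  open ≡-Reasoning

  ip-as-sum : ∀ u v → ip u v ≡ ∑[ i < n ] ∑[ j < n ] (lookup u i ℚ.* (gram i j ℚ.* lookup v j))
  ip-as-sum u v = trans (Σ≡sum n _) (sum-cong-≗ (λ i → Σ≡sum n (λ j → lookup u i ℚ.* (gram i j ℚ.* lookup v j))))

  ip-distribʳ-+ᵥ : ∀ x y v → ip (x +ᵥ y) v ≡ ip x v ℚ.+ ip y v
  ip-distribʳ-+ᵥ x y v = begin
    ip (x +ᵥ y) v
      ≡⟨ ip-as-sum (x +ᵥ y) v ⟩
    ∑[ i < n ] ∑[ j < n ] (lookup (x +ᵥ y) i ℚ.* gv i j)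
      ≡⟨ sum-cong-≗ (λ i → sum-cong-≗ (λ j → distrib i j)) ⟩
    ∑[ i < n ] ∑[ j < n ] (lookup x i ℚ.* gv i j ℚ.+ lookup y i ℚ.* gv i j)
      ≡⟨ sum-cong-≗ (λ i → ∑-distrib-+ (λ j → lookup x i ℚ.* gv i j) (λ j → lookup y i ℚ.* gv i j)) ⟩
    ∑[ i < n ] (∑[ j < n ] (lookup x i ℚ.* gv i j) ℚ.+ ∑[ j < n ] (lookup y i ℚ.* gv i j))
      ≡⟨ ∑-distrib-+ (λ i → ∑[ j < n ] (lookup x i ℚ.* gv i j)) (λ i → ∑[ j < n ] (lookup y i ℚ.* gv i j)) ⟩
    ∑[ i < n ] ∑[ j < n ] (lookup x i ℚ.* gv i j) ℚ.+ ∑[ i < n ] ∑[ j < n ] (lookup y i ℚ.* gv i j)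
      ≡⟨ sym (cong₂ ℚ._+_ (ip-as-sum x v) (ip-as-sum y v)) ⟩
    ip x v ℚ.+ ip y v
      ∎
    where
    gv : Fin n → Fin n → ℚ
    gv i j = gram i j ℚ.* lookup v j
    distrib : ∀ i j → lookup (x +ᵥ y) i ℚ.* gv i j ≡ lookup x i ℚ.* gv i j ℚ.+ lookup y i ℚ.* gv i j
    distrib i j = trans (cong (ℚ._* gv i j) (VP.lookup-zipWith ℚ._+_ i x y))
                        (ℚP.*-distribʳ-+ (gv i j) (lookup x i) (lookup y i))

  toV-simple-diagonal : ∀ (k : Fin n) → lookup (toV (simple k)) k ≡ 1ℚ
  toV-simple-diagonal k = trans (VP.lookup-map k ℤ→ℚ (simple k)) (cong ℤ→ℚ (simple-diagonal k))

  toV-simple-off-diagonal : ∀ {k j : Fin n} → k ≢ j → lookup (toV (simple k)) j ≡ 0ℚ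
  toV-simple-off-diagonal {k} {j} k≢j =
    trans (VP.lookup-map j ℤ→ℚ (simple k)) (cong ℤ→ℚ (simple-off-diagonal k≢j))

  ip-simpleʳ : ∀ u k → ip u (toV (simple k)) ≡ ∑[ i < n ] (lookup u i ℚ.* gram i k)
  ip-simpleʳ u k = trans (ip-as-sum u (toV (simple k))) (sum-cong-≗ row)
    where
    row : ∀ i → ∑[ j < n ] (lookup u i ℚ.* (gram i j ℚ.* lookup (toV (simple k)) j))
              ≡ lookup u i ℚ.* gram i k
    row i = trans (sum-cong-≗ (λ j → sym (ℚP.*-assoc (lookup u i) (gram i j) _)))
                  (sum-indicator ℚ-semiring (λ j → lookup u i ℚ.* gram i j) (lookup (toV (simple k)))
                                 k (toV-simple-diagonal k) toV-simple-off-diagonal)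

  ip-expandʳ : ∀ u v → ip u v ≡ ∑[ j < n ] (ip u (toV (simple j)) ℚ.* lookup v j)
  ip-expandʳ u v = begin
    ip u v
      ≡⟨ ip-as-sum u v ⟩
    ∑[ i < n ] ∑[ j < n ] (lookup u i ℚ.* (gram i j ℚ.* lookup v j))
      ≡⟨ sum-cong-≗ (λ i → sum-cong-≗ (λ j → sym (ℚP.*-assoc (lookup u i) (gram i j) (lookup v j)))) ⟩
    ∑[ i < n ] ∑[ j < n ] (lookup u i ℚ.* gram i j ℚ.* lookup v j)
      ≡⟨ ∑-comm (λ i j → lookup u i ℚ.* gram i j ℚ.* lookup v j) ⟩
    ∑[ j < n ] ∑[ i < n ] (lookup u i ℚ.* gram i j ℚ.* lookup v j)
      ≡⟨ sum-cong-≗ (λ j → sym (*-distribʳ-sum (lookup v j) (λ i → lookup u i ℚ.* gram i j))) ⟩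
    ∑[ j < n ] (∑[ i < n ] (lookup u i ℚ.* gram i j) ℚ.* lookup v j)
      ≡⟨ sum-cong-≗ (λ j → cong (ℚ._* lookup v j) (sym (ip-simpleʳ u j))) ⟩
    ∑[ j < n ] (ip u (toV (simple j)) ℚ.* lookup v j)
      ∎

  ip-fundamental : ∀ {ω} → AreFundamentalWeights ω → ∀ i v → ip (ω i) v ≡ lookup v i
  ip-fundamental {ω} fw i v = begin
    ip (ω i) v                               ≡⟨ ip-expandʳ (ω i) v ⟩
    ∑[ j < n ] (ip (ω i) (toV (simple j)) ℚ.* lookup v j)
      ≡⟨ sum-cong-≗ (λ j → trans (cong (ℚ._* lookup v j) (fw i j)) (ℚP.*-comm (δ i j) (lookup v j))) ⟩
    ∑[ j < n ] (lookup v j ℚ.* δ i j)        ≡⟨ sum-indicator ℚ-semiring (lookup v) (δ i) i (δ-diagonal i) δ-off-diagonal ⟩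
    lookup v i                               ∎

  lab : (Vec ℤ n → ℤ) → List ℤ
  lab h = List.map h posRoots

  InStrips : (Vec ℤ n → ℤ) → V n → Set
  InStrips h x = All.All (λ α → Between (h α) (ip x (toV α))) posRoots

  InAlcove-lab : ∀ h x → InAlcove (lab h) x ⇔ InStrips h x
  InAlcove-lab h x = mk⇔ (λ x∈ → AllP.map⁻ (subst (All.All _) (zip-map-self h posRoots) x∈))
                         (λ x∈ → subst (All.All _) (sym (zip-map-self h posRoots)) (AllP.map⁺ x∈))

  module _ {λ′ : V n} {d : Vec ℤ n → ℤ} (integral : ∀ α → ip λ′ (toV α) ≡ ℤ→ℚ (d α)) where

    ip-translate : ∀ y α → ip (y +ᵥ λ′) (toV α) ≡ ip y (toV α) ℚ.+ ℤ→ℚ (d α)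
    ip-translate y α = trans (ip-distribʳ-+ᵥ y λ′ (toV α)) (cong (ip y (toV α) ℚ.+_) (integral α))

    InStrips-translate : ∀ h y → InStrips h y ⇔ InStrips (h +ᶠ d) (y +ᵥ λ′)
    InStrips-translate h y = mk⇔ (All.map (λ {α} → to α)) (All.map (λ {α} → from α))
      where
      to : ∀ α → Between (h α) (ip y (toV α)) → Between ((h +ᶠ d) α) (ip (y +ᵥ λ′) (toV α))
      to α b = subst (Between ((h +ᶠ d) α)) (sym (ip-translate y α))
                     (Equivalence.to (between-translate (h α) (d α) (ip y (toV α))) b)
      from : ∀ α → Between ((h +ᶠ d) α) (ip (y +ᵥ λ′) (toV α)) → Between (h α) (ip y (toV α))
      from α b = Equivalence.from (between-translate (h α) (d α) (ip y (toV α)))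
                                  (subst (Between ((h +ᶠ d) α)) (ip-translate y α) b)

    InAlcove-translate : ∀ h y → InAlcove (lab h) y ⇔ InAlcove (lab (h +ᶠ d)) (y +ᵥ λ′)
    InAlcove-translate h y =
      ⇔-sym (InAlcove-lab (h +ᶠ d) (y +ᵥ λ′)) ⇔-∘ (InStrips-translate h y ⇔-∘ InAlcove-lab h y)

    translate-star : ∀ h → IsAlcove (lab h) → Star (lab h) λ′ (lab (h +ᶠ d))
    translate-star h (_ , y , y∈) =
      (LP.length-map (h +ᶠ d) posRoots , y +ᵥ λ′ , Equivalence.to (InAlcove-translate h y) y∈) ,
      λ x → mk⇔ (to x) (from x)
      where
      untranslate : ∀ x → (x +ᵥ Vec.map ℚ.-_ λ′) +ᵥ λ′ ≡ x
      untranslate x = trans (VP.zipWith-assoc ℚP.+-assoc x (Vec.map ℚ.-_ λ′) λ′)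
        (trans (cong (x +ᵥ_) (VP.zipWith-inverseˡ ℚP.+-inverseˡ λ′)) (VP.zipWith-identityʳ ℚP.+-identityʳ x))
      to : ∀ x → InAlcove (lab (h +ᶠ d)) x → ∃ λ y → InAlcove (lab h) y × x ≡ y +ᵥ λ′
      to x x∈ = x +ᵥ Vec.map ℚ.-_ λ′ ,
        Equivalence.from (InAlcove-translate h (x +ᵥ Vec.map ℚ.-_ λ′))
                         (subst (InAlcove (lab (h +ᶠ d))) (sym (untranslate x)) x∈) ,
        sym (untranslate x)
      from : ∀ x → (∃ λ y → InAlcove (lab h) y × x ≡ y +ᵥ λ′) → InAlcove (lab (h +ᶠ d)) x
      from _ (y , y∈ , refl) = Equivalence.to (InAlcove-translate h y) y∈

    translate-grassmannian : ∀ h → (∀ {α} → α ∈ posRoots → ℤ.+ 0 ℤ.≤ d α) →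
                             IsGrassmannian (lab h) → IsGrassmannian (lab (h +ᶠ d))
    translate-grassmannian h d≥0 (alcove , chamber) = proj₁ star , nonneg
      where
      star : Star (lab h) λ′ (lab (h +ᶠ d))
      star = translate-star h alcove
      nonneg : ∀ x → InAlcove (lab (h +ᶠ d)) x → ∀ {α} → α ∈ posRoots → 0ℚ ℚ.≤ ip x (toV α)
      nonneg x x∈ {α} α∈ with Equivalence.to (proj₂ star x) x∈
      ... | y , y∈ , refl = subst (0ℚ ℚ.≤_) (sym (ip-translate y α))
                                  (ℚP.+-mono-≤ (chamber y y∈ α∈) (ℤ→ℚ-mono-≤ (d≥0 α∈)))

  nonneg? : ∀ (α : Vec ℤ n) → Dec (VAll.All (ℤ.+ 0 ℤ.≤_) α)
  nonneg? α = VAll.all? (ℤ.+ 0 ℤ.≤?_) α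

  coord : Fin n → Vec ℤ n → ℤ
  coord i α = lookup α i

  fundamental-integral : ∀ {ω} → AreFundamentalWeights ω → ∀ i α → ip (ω i) (toV α) ≡ ℤ→ℚ (coord i α)
  fundamental-integral {ω} fw i α = trans (ip-fundamental {ω} fw i (toV α)) (VP.lookup-map i ℤ→ℚ α)

  posRoot-coord-nonneg : ∀ {α} → α ∈ posRoots → ∀ i → ℤ.+ 0 ℤ.≤ coord i α
  posRoot-coord-nonneg α∈ = VAllP.lookup⁺ (proj₂ (∈-filter⁻ nonneg? {xs = roots} α∈))

  simple∈posRoots : ∀ j → simple j ∈ posRoots
  simple∈posRoots j = ∈-filter⁺ nonneg? (simple∈ j) (VAllP.lookup⁻ nonneg)
    where
    nonneg : ∀ k → ℤ.+ 0 ℤ.≤ lookup (simple j) k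
    nonneg k with j ≟ k
    ... | yes refl = subst (ℤ.+ 0 ℤ.≤_) (sym (simple-diagonal j)) (ℤ.+≤+ z≤n)
    ... | no j≢k   = subst (ℤ.+ 0 ℤ.≤_) (sym (simple-off-diagonal j≢k)) ℤP.≤-refl

  star-source-inhabited : ∀ {w λ′ w′} → Star w λ′ w′ → ∃ (InAlcove w)
  star-source-inhabited ((_ , x , x∈) , star) with Equivalence.to (star x) x∈
  ... | y , y∈ , _ = y , y∈

  A₀-grassmannian : ∃ (InAlcove A₀) → IsGrassmannian A₀
  A₀-grassmannian inhabited = (LP.length-map _ posRoots , inhabited) ,
    λ x x∈ α∈ → ℚP.<⇒≤ (proj₁ (All.lookup (Equivalence.to (InAlcove-lab _ x) x∈) α∈))

module _ {c ℓ} (Λ : QAlgebra c ℓ) where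
  open QAlgebra Λ using (Carrier; _≈_; _+_; _*_; ι; lincomb; setoid; distribˡ; +-cong; zeroʳ; *-congˡ; *-commutativeSemigroup)
    renaming (trans to ≈-trans)
  open CommutativeSemigroupProperties *-commutativeSemigroup using (x∙yz≈y∙xz)
  open import Relation.Binary.Reasoning.Setoid setoid

  *-lincomb : ∀ {A : Set} (coeff : A → ℚ) {x y : A → Carrier} a → (∀ q → a * x q ≈ y q) → ∀ qs →
              a * lincomb (List.map (λ q → coeff q , x q) qs) ≈ lincomb (List.map (λ q → coeff q , y q) qs)
  *-lincomb coeff a ax≈y []       = zeroʳ a
  *-lincomb coeff {x} {y} a ax≈y (q ∷ qs) = begin
    a * (ι (coeff q) * x q + rest)      ≈⟨ distribˡ a _ rest ⟩
    a * (ι (coeff q) * x q) + a * rest  ≈⟨ +-cong (≈-trans (x∙yz≈y∙xz a _ (x q)) (*-congˡ (ax≈y q)))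
                                                   (*-lincomb coeff a ax≈y qs) ⟩
    ι (coeff q) * y q + lincomb (List.map (λ q → coeff q , y q) qs) ∎
    where
    rest : Carrier
    rest = lincomb (List.map (λ q → coeff q , x q) qs)

module SchubertTranslates {n : ℕ} (R : RootSystem n) {ω : Fin n → V n}
                          (fw : RootSystem.AreFundamentalWeights R ω)
                          {c ℓ : Level} (Λ : QAlgebra c ℓ) (B : SchubertBasis R ω Λ)
                          (t : Fin n → List ℤ)
                          (ts : ∀ i → RootSystem.Star R (RootSystem.A₀ R) (ω i) (t i)) where
  open RootSystem R using (A₀; IsGrassmannian; posRoots; ip)
  open Alcoves R
  open QAlgebra Λ
    using (Carrier; _≈_; _*_; _^_; 1#; lincomb; monomial; evalPoly; setoid;
           reflexive; *-assoc; *-congʳ; *-identityʳ)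
    renaming (sym to ≈-sym; trans to ≈-trans)
  open SchubertBasis B using (ξ; factor)
  open import Relation.Binary.Reasoning.Setoid setoid

  X : Fin n → Carrier
  X i = ξ (t i)

  MultipliesTo : (Vec ℤ n → ℤ) → Carrier → (Vec ℤ n → ℤ) → Set _
  MultipliesTo h m h′ = IsGrassmannian (lab h′) × ξ (lab h) * m ≈ ξ (lab h′)

  multipliesTo-1# : ∀ {h} → IsGrassmannian (lab h) → MultipliesTo h 1# h
  multipliesTo-1# grass = grass , *-identityʳ _

  multipliesTo-* : ∀ {h h₁ h₂ a b} → MultipliesTo h a h₁ → MultipliesTo h₁ b h₂ → MultipliesTo h (a * b) h₂
  multipliesTo-* {h} {h₁} {h₂} {a} {b} (_ , ha≈h₁) (grass , h₁b≈h₂) = grass , (begin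
    ξ (lab h) * (a * b)  ≈⟨ ≈-sym (*-assoc _ a b) ⟩
    ξ (lab h) * a * b    ≈⟨ *-congʳ ha≈h₁ ⟩
    ξ (lab h₁) * b       ≈⟨ h₁b≈h₂ ⟩
    ξ (lab h₂)           ∎)

  multipliesTo-relabel : ∀ {h m h′ h″} → MultipliesTo h m h′ → (∀ α → h′ α ≡ h″ α) → MultipliesTo h m h″
  multipliesTo-relabel {h′ = h′} {h″} (grass , eq) h′≗h″ =
    subst IsGrassmannian lab≡ grass , ≈-trans eq (reflexive (cong ξ lab≡))
    where
    lab≡ : lab h′ ≡ lab h″
    lab≡ = LP.map-cong h′≗h″ posRoots

  ξ-*-X : ∀ i {h} → IsGrassmannian (lab h) → MultipliesTo h (X i) (h +ᶠ coord i)
  ξ-*-X i {h} grass =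
    translate-grassmannian {ω i} integral h (λ α∈ → posRoot-coord-nonneg α∈ i) grass ,
    ≈-sym (factor (lab h) i (lab (h +ᶠ coord i)) (t i) grass (translate-star integral h (proj₁ grass)) (ts i))
    where
    integral : ∀ α → ip (ω i) (toV α) ≡ ℤ→ℚ (coord i α)
    integral = fundamental-integral {ω} fw i

  _·ᶠ_ : ℕ → (Vec ℤ n → ℤ) → Vec ℤ n → ℤ
  (k ·ᶠ f) α = ℤ.+ k ℤ.* f α

  ξ-*-X^ : ∀ i k {h} → IsGrassmannian (lab h) → MultipliesTo h (X i ^ k) (h +ᶠ (k ·ᶠ coord i))
  ξ-*-X^ i ℕ.zero    {h} grass = multipliesTo-relabel (multipliesTo-1# grass) (λ α → sym (ℤP.+-identityʳ (h α)))
  ξ-*-X^ i (ℕ.suc k) {h} grass =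
    multipliesTo-relabel (multipliesTo-* step (ξ-*-X^ i k (proj₁ step))) (λ α →
      trans (ℤP.+-assoc (h α) (coord i α) _) (cong (ℤ._+_ (h α)) (sym (ℤP.suc-* (ℤ.+ k) (coord i α)))))
    where
    step : MultipliesTo h (X i) (h +ᶠ coord i)
    step = ξ-*-X i grass

  -- the label shift caused by translating by Σ_k e_k ω_{g k}
  pairing : ∀ {m} → (Fin m → Fin n) → Vec ℕ m → Vec ℤ n → ℤ
  pairing g e α = ℤΣ.sum (λ k → ℤ.+ lookup e k ℤ.* coord (g k) α)

  ξ-*-monomial : ∀ {m} (g : Fin m → Fin n) e {h} → IsGrassmannian (lab h) →
                 MultipliesTo h (monomial (X ∘ g) e) (h +ᶠ pairing g e)
  ξ-*-monomial g []      {h} grass = multipliesTo-relabel (multipliesTo-1# grass) (λ α → sym (ℤP.+-identityʳ (h α)))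
  ξ-*-monomial g (k ∷ e) {h} grass =
    multipliesTo-relabel (multipliesTo-* power (ξ-*-monomial (g ∘ suc) e (proj₁ power)))
                         (λ α → ℤP.+-assoc (h α) _ _)
    where
    power : MultipliesTo h (X (g zero) ^ k) (h +ᶠ (k ·ᶠ coord (g zero)))
    power = ξ-*-X^ (g zero) k grass

  pairing-simple : ∀ e j → pairing id e (simple j) ≡ ℤ.+ lookup e j
  pairing-simple e j = sum-indicator ℤP.+-*-semiring (λ k → ℤ.+ lookup e k) (λ k → lookup (simple j) k) j
                                     (simple-diagonal j) simple-off-diagonal

  -- The alcove A₀ + Σ_i e_i ω_i.
  shiftedA₀ : Vec ℕ n → List ℤ
  shiftedA₀ e = lab (pairing id e)

  shiftedA₀-injective : ∀ {e e′} → shiftedA₀ e ≡ shiftedA₀ e′ → e ≡ e′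
  shiftedA₀-injective {e} {e′} eq =
    trans (sym (VP.tabulate∘lookup e)) (trans (VP.tabulate-cong lookup≗) (VP.tabulate∘lookup e′))
    where
    lookup≗ : ∀ j → lookup e j ≡ lookup e′ j
    lookup≗ j = ℤP.+-injective (trans (sym (pairing-simple e j))
                  (trans (All.lookup (map-cong-local⁻ eq) (simple∈posRoots j)) (pairing-simple e′ j)))

  -- Nothing asserts that A₀ is nonempty; a point of it is pulled back from the alcove of t_{ω_i}.
  A₀-isGrassmannian : IsGrassmannian A₀
  A₀-isGrassmannian = A₀-grassmannian (star-source-inhabited (ts (positive-rank R)))

  ξA₀-*-monomial : ∀ e → MultipliesTo (λ _ → ℤ.+ 0) (monomial X e) (pairing id e)
  ξA₀-*-monomial e = multipliesTo-relabel (ξ-*-monomial id e A₀-isGrassmannian) (λ α → ℤP.+-identityˡ _)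

  relabel : List (ℚ × Vec ℕ n) → List (ℚ × List ℤ)
  relabel = List.map (map₂ shiftedA₀)

  relabel-grassmannian : ∀ p → All.All (λ w → IsGrassmannian (proj₂ w)) (relabel p)
  relabel-grassmannian p = AllP.map⁺ (All.tabulate (λ {q} _ → proj₁ (ξA₀-*-monomial (proj₂ q))))

  relabel-unique : ∀ p → Unique (List.map proj₂ p) → Unique (List.map proj₂ (relabel p))
  relabel-unique p distinct =
    subst Unique (trans (sym (LP.map-∘ p)) (LP.map-∘ p)) (UniqueP.map⁺ shiftedA₀-injective distinct)

  ξA₀-*-evalPoly : ∀ p → ξ A₀ * evalPoly p X ≈ lincomb (List.map (λ w → proj₁ w , ξ (proj₂ w)) (relabel p))
  ξA₀-*-evalPoly p = ≈-trans (*-lincomb Λ proj₁ (ξ A₀) (λ q → proj₂ (ξA₀-*-monomial (proj₂ q))) p)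
                             (reflexive (cong lincomb (LP.map-∘ p)))

lemma5p5 : ∀ {n : ℕ} (R : RootSystem n) (ω : Fin n → V n) →
    RootSystem.AreFundamentalWeights R ω →
    ∀ {c ℓ : Level} (Λ : QAlgebra c ℓ) (B : SchubertBasis R ω Λ) →
    (t : Fin n → List ℤ) → (∀ i → RootSystem.Star R (RootSystem.A₀ R) (ω i) (t i)) →
    QAlgebra.AlgebraicallyIndependent Λ (λ i → SchubertBasis.ξ B (t i))
lemma5p5 R ω fw Λ B t ts p distinct p[X]≈0 =
  AllP.map⁻ (independent (relabel p) (relabel-grassmannian p) (relabel-unique p distinct) combination≈0)
  where
  open SchubertTranslates R fw Λ B t ts
  open QAlgebra Λ using (_≈_; 0#; _*_; lincomb; *-congˡ; zeroʳ) renaming (sym to ≈-sym; trans to ≈-trans)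
  open SchubertBasis B using (ξ; independent)
  combination≈0 : lincomb (List.map (λ w → proj₁ w , ξ (proj₂ w)) (relabel p)) ≈ 0#
  combination≈0 = ≈-trans (≈-sym (ξA₀-*-evalPoly p)) (≈-trans (*-congˡ p[X]≈0) (zeroʳ _))
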